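{- For every integer $n\ge 0$, $S[\check1,\check1,\check n]$ is a $p(n+1)$-moves state and $S[\check1,\check1,\hat n]$ is a $p(n)$-moves state. Consequently $g(S[\check1,\check1,\check n])=\bar n\oplus 1$ and $g(S[\check1,\check1,\hat n])=\bar n$.
   Context: A decoration of a graph is a set of arrows on edges, at most one per edge; a vertex is a sink (source) if all its edges carry arrows into (out of) it; a state is a decoration with no sink or source at a vertex of degree $\ge2$. A follower of a state $X$ is a state $X\cup\{(v,w)\}$ with $\{v,w\}$ unmarked in $X$; descendents are iterated followers; terminal = no followers. Grundy value $g(X)=\mathrm{mex}\{g(Y):Y\text{ follower of }X\}$; $\oplus$ nim-sum; $\bar n=n\bmod2$. A state $X$ is a $p(m)$-moves state if for every terminal state $X^*$ equal to $X$ or a descendent of $X$, $|X^*\setminus X|\equiv m\pmod 2$. Spider $S(a,b,c)$: hub $h$, legs $h=u_0,\dots,u_a$; $h=v_0,\dots,v_b$; $h=w_0,\dots,w_c$. Notation $S[x,y,z]$: in the first entry, $\hat n$ means the $u$-leg has length $n+1$ and carries the arrow $(u_n,u_{n+1})$ (away from hub), $\check n$ means length $n+1$ and arrow $(u_{n+1},u_n)$ (toward hub); second and third entries likewise for $v$- and $w$-legs; $S[x,y,z]$ is the resulting state of the resulting spider. -}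

module Defs where

open import Data.Nat using (ℕ; zero; suc; _+_; _*_; _≡ᵇ_; _≤ᵇ_; _<_; _≤_)
open import Data.Nat.DivMod using (_%_; _/_)
open import Data.Bool using (Bool; true; false; not; _∧_; _∨_; if_then_else_; T)
open import Data.Maybe using (Maybe; just; nothing)
open import Data.Product using (_×_; _,_; Σ)
open import Data.List as List using (List; []; _∷_; upTo; concatMap; length; filter)
open import Data.Bool.ListAction using (all; any)
open import Data.Fin using (Fin; toℕ)
open import Data.Vec as Vec using (Vec; lookup; _[_]≔_; tabulate; replicate; _∷ʳ_; zip; toList)
open import Relation.Binary.PropositionalEquality using (_≡_; _≢_)
open import Relation.Nullary using (¬_)

-- Finite graphs.  Vertices are the naturals 0 .. V-1; the graph has E
-- edges, the i-th edge joining the two vertices in `edges[i]`.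

record Graph : Set where
  field
    V     : ℕ
    E     : ℕ
    edges : Vec (ℕ × ℕ) E
open Graph public

-- A decoration: for each edge {x,y} (listed as (x , y)) either no arrow
-- (nothing), the arrow (x,y) (just true) or the arrow (y,x) (just false).
-- This is exactly "a set of arrows, at most one per edge".
Decoration : Graph → Set
Decoration G = Vec (Maybe Bool) (E G)

incident : ℕ → ℕ × ℕ → Bool
incident v (x , y) = (v ≡ᵇ x) ∨ (v ≡ᵇ y)

arrowInto : ℕ → ℕ × ℕ → Maybe Bool → Bool
arrowInto v (x , y) (just true)  = v ≡ᵇ y
arrowInto v (x , y) (just false) = v ≡ᵇ x
arrowInto v (x , y) nothing      = false

arrowOutOf : ℕ → ℕ × ℕ → Maybe Bool → Bool
arrowOutOf v (x , y) (just true)  = v ≡ᵇ x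
arrowOutOf v (x , y) (just false) = v ≡ᵇ y
arrowOutOf v (x , y) nothing      = false

edgeMarks : (G : Graph) → Decoration G → List ((ℕ × ℕ) × Maybe Bool)
edgeMarks G d = toList (zip (edges G) d)

degree : Graph → ℕ → ℕ
degree G v = length (filter (λ e → T? (incident v e)) (toList (edges G)))
  where
    open import Relation.Nullary.Decidable using (Dec)
    open import Data.Bool.Properties using (T?)

isSink : (G : Graph) → Decoration G → ℕ → Bool
isSink G d v = all (λ { (e , m) → not (incident v e) ∨ arrowInto v e m }) (edgeMarks G d)

isSource : (G : Graph) → Decoration G → ℕ → Bool
isSource G d v = all (λ { (e , m) → not (incident v e) ∨ arrowOutOf v e m }) (edgeMarks G d)

isState : (G : Graph) → Decoration G → Bool
isState G d = all (λ v → not (2 ≤ᵇ degree G v) ∨ (not (isSink G d v) ∧ not (isSource G d v))) (upTo (V G))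

IsState : (G : Graph) → Decoration G → Set
IsState G d = T (isState G d)

Follower : (G : Graph) → Decoration G → Decoration G → Set
Follower G X Y = Σ (Fin (E G)) λ e → Σ Bool λ b →
  lookup X e ≡ nothing × Y ≡ (X [ e ]≔ just b) × IsState G Y

data ReachableFrom (G : Graph) : Decoration G → Decoration G → Set where
  here : ∀ {X} → ReachableFrom G X X
  step : ∀ {X Y Z} → Follower G X Y → ReachableFrom G Y Z → ReachableFrom G X Z

Terminal : (G : Graph) → Decoration G → Set
Terminal G X = ∀ Y → ¬ Follower G X Y

isNothing : Maybe Bool → Bool
isNothing nothing  = true
isNothing (just _) = false

newArrows : (G : Graph) → Decoration G → Decoration G → ℕ
newArrows G X Y = List.length (List.filter (λ p → T? (isNothing (Data.Product.proj₁ p) ∧ not (isNothing (Data.Product.proj₂ p)))) (toList (zip X Y)))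
  where open import Data.Bool.Properties using (T?)

PMoves : (G : Graph) → Decoration G → ℕ → Set
PMoves G X m = IsState G X ×
  (∀ X* → ReachableFrom G X X* → Terminal G X* → newArrows G X X* % 2 ≡ m % 2)

followers : (G : Graph) → Decoration G → List (Decoration G)
followers G X = concatMap (λ e → concatMap (λ b →
    if isNothing (lookup X e) ∧ isState G (X [ e ]≔ just b)
    then (X [ e ]≔ just b) ∷ [] else []) (true ∷ false ∷ [])) (List.allFin (E G))

memberᵇ : ℕ → List ℕ → Bool
memberᵇ k xs = any (k ≡ᵇ_) xs

mexFrom : ℕ → ℕ → List ℕ → ℕ
mexFrom zero     k xs = k
mexFrom (suc f)  k xs = if memberᵇ k xs then mexFrom f (suc k) xs else k

-- mex xs = least natural not in xs (it is ≤ length xs, so this fuel suffices)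
mex : List ℕ → ℕ
mex xs = mexFrom (suc (length xs)) 0 xs

-- each follower has one fewer unmarked edge, so depth ≤ E suffices
grundyFuel : (G : Graph) → ℕ → Decoration G → ℕ
grundyFuel G zero    X = 0
grundyFuel G (suc f) X = mex (List.map (grundyFuel G f) (followers G X))

grundy : (G : Graph) → Decoration G → ℕ
grundy G X = grundyFuel G (E G) X

xorBit : ℕ → ℕ → ℕ
xorBit a b = if (a % 2) ≡ᵇ (b % 2) then 0 else 1

nimFuel : ℕ → ℕ → ℕ → ℕ
nimFuel zero    a b = 0
nimFuel (suc f) a b = xorBit a b + 2 * nimFuel f (a / 2) (b / 2)

_⊕_ : ℕ → ℕ → ℕ
a ⊕ b = nimFuel (a + b) a b

-- Spiders.  Hub h = 0; u_i = i (1 ≤ i ≤ a); v_i = a + i; w_i = a + b + i.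

legVertex : ℕ → ℕ → ℕ
legVertex o zero    = 0
legVertex o (suc i) = o + suc i

-- edges of a leg of length L: edge i joins leg-vertex i and i+1 (listed in
-- that order, so "just true" is the arrow pointing away from the hub)
legEdges : (o L : ℕ) → Vec (ℕ × ℕ) L
legEdges o L = tabulate (λ i → legVertex o (toℕ i) , legVertex o (suc (toℕ i)))

Spider : ℕ → ℕ → ℕ → Graph
Spider a b c = record
  { V = suc (a + b + c)
  ; E = a + b + c
  ; edges = (legEdges 0 a Vec.++ legEdges a b) Vec.++ legEdges (a + b) c }

-- hat n : arrow (x_n , x_{n+1}) (away from hub); check n : arrow (x_{n+1} , x_n)
data LegSpec : Set where
  hat   : ℕ → LegSpec
  check : ℕ → LegSpec

legLen : LegSpec → ℕ
legLen (hat n)   = suc n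
legLen (check n) = suc n

legDec : (s : LegSpec) → Vec (Maybe Bool) (legLen s)
legDec (hat n)   = replicate n nothing ∷ʳ just true
legDec (check n) = replicate n nothing ∷ʳ just false

SpiderOf : LegSpec → LegSpec → LegSpec → Graph
SpiderOf x y z = Spider (legLen x) (legLen y) (legLen z)

S[_,_,_] : (x y z : LegSpec) → Decoration (SpiderOf x y z)
S[ x , y , z ] = (legDec x Vec.++ legDec y) Vec.++ legDec z

-- Arrows are only ever added, so the number of moves from a state to a descendent is the number of
-- unmarked edges it loses.  In a terminal descendent of S[1̌,1̌,ň] or S[1̌,1̌,n̂] every leg is blocked:
-- an unmarked leg edge is isolated and the arrows on both sides of it point towards it, so along the
-- w-leg the parity of the unmarked edges is the number of direction changes between its first and
-- last arrow.  A case analysis at the hub then shows that the terminal state has an odd number of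
-- unmarked edges exactly when its last w-arrow points toward the hub.  That arrow is already present
-- in the start state, which has n+2 unmarked edges, so modulo 2 every play from S[1̌,1̌,ň] has n+1
-- moves and every play from S[1̌,1̌,n̂] has n.  Finally, every follower of a p(m)-moves state is a
-- p(m+1)-moves state, so by induction on the number of unmarked edges its Grundy value is m mod 2.
module Submission where

open import Defs
open import Data.Nat using (ℕ; zero; suc; _+_; _≤_; _<_; _≤ᵇ_; _<ᵇ_; _≡ᵇ_; z≤n; s≤s; s≤s⁻¹)
open import Data.Nat.Properties using (<⇒≢; >⇒≢; n<1+n; <-trans; ≤-trans; n≤1+n; <ᵇ⇒<; +-suc; +-identityʳ; +-cancelʳ-≡; n≤0⇒n≡0; 0≢1+n)
open import Data.Nat.DivMod using (_%_)
open import Data.Bool using (Bool; true; false; not; _∧_; _∨_; _xor_; if_then_else_; T)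
open import Data.Bool.Properties using (T?; T-∧; ∧-assoc; ∧-identityʳ; not-involutive; xor-assoc; xor-comm; xor-same; xor-identityʳ)
open import Data.Bool.ListAction using (all; and)
open import Data.Maybe using (Maybe; just; nothing)
open import Data.Product using (_×_; _,_; proj₁; proj₂)
open import Data.Unit using (tt)
open import Data.Empty using (⊥-elim)
open import Data.Fin using (Fin; toℕ) renaming (zero to fzero; suc to fsuc)
open import Data.List as List using (List; []; _∷_; _++_; applyUpTo; upTo)
open import Data.List.Properties using (++-assoc; ++-identityʳ; map-cong)
open import Data.List.Relation.Unary.All as All using (All; []; _∷_)
open import Data.List.Relation.Unary.All.Properties using (++⁺; map⁺)
open import Data.List.Relation.Unary.Any as Any using (here; there)
open import Data.List.Membership.Propositional using (_∈_; lose)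
open import Data.List.Membership.Propositional.Properties using (∈-concatMap⁻; ∈-concatMap⁺; ∈-allFin)
open import Data.Vec as Vec using (Vec; []; _∷_; lookup; _[_]≔_; toList; zip; tabulate; replicate; _∷ʳ_)
open import Data.Vec.Relation.Binary.Pointwise.Inductive as Pointwise using (Pointwise; []; _∷_)
open import Function using (_∘_)
open import Function.Bundles using (Equivalence)
open import Relation.Binary.PropositionalEquality
open import Relation.Nullary using (¬_)

module T-∧ {x y} = Equivalence (T-∧ {x} {y})

-- Decorations grow along plays

Mark : Set
Mark = Maybe Bool

data _⊑_ : Mark → Mark → Set where
  nothing⊑ : ∀ {m} → nothing ⊑ m
  just⊑just : ∀ {b} → just b ⊑ just b

⊑-refl : ∀ {m} → m ⊑ m
⊑-refl {nothing} = nothing⊑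
⊑-refl {just _}  = just⊑just

⊑-trans : ∀ {l m n} → l ⊑ m → m ⊑ n → l ⊑ n
⊑-trans nothing⊑   _ = nothing⊑
⊑-trans just⊑just q = q

Extends : ∀ {k} → Vec Mark k → Vec Mark k → Set
Extends = Pointwise _⊑_

Extends-[]≔ : ∀ {k} (X : Vec Mark k) i m → lookup X i ≡ nothing → Extends X (X [ i ]≔ m)
Extends-[]≔ (_ ∷ X) fzero    m refl = nothing⊑ ∷ Pointwise.refl ⊑-refl
Extends-[]≔ (_ ∷ X) (fsuc i) m eq   = ⊑-refl ∷ Extends-[]≔ X i m eq

unmarked : ∀ {k} → Vec Mark k → ℕ
unmarked []            = 0
unmarked (nothing ∷ X) = suc (unmarked X)
unmarked (just _ ∷ X)  = unmarked X

unmarked-[]≔ : ∀ {k} (X : Vec Mark k) i b → lookup X i ≡ nothing →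
               suc (unmarked (X [ i ]≔ just b)) ≡ unmarked X
unmarked-[]≔ (_ ∷ X)       fzero    b refl = refl
unmarked-[]≔ (nothing ∷ X) (fsuc i) b eq   = cong suc (unmarked-[]≔ X i b eq)
unmarked-[]≔ (just _ ∷ X)  (fsuc i) b eq   = unmarked-[]≔ X i b eq

unmarked≤length : ∀ {k} (X : Vec Mark k) → unmarked X ≤ k
unmarked≤length []            = z≤n
unmarked≤length (nothing ∷ X) = s≤s (unmarked≤length X)
unmarked≤length (just _ ∷ X)  = ≤-trans (unmarked≤length X) (n≤1+n _)

-- `newArrows G` does not depend on G; this is its body over decorations of any length.
addedArrows : ∀ {k} → Vec Mark k → Vec Mark k → ℕ
addedArrows X Y = List.length (List.filter (λ p → T? (isNothing (proj₁ p) ∧ not (isNothing (proj₂ p)))) (toList (zip X Y)))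

addedArrows-refl : ∀ {k} (X : Vec Mark k) → addedArrows X X ≡ 0
addedArrows-refl []            = refl
addedArrows-refl (nothing ∷ X) = addedArrows-refl X
addedArrows-refl (just _ ∷ X)  = addedArrows-refl X

addedArrows+unmarked : ∀ {k} {X Y : Vec Mark k} → Extends X Y → addedArrows X Y + unmarked Y ≡ unmarked X
addedArrows+unmarked [] = refl
addedArrows+unmarked {X = nothing ∷ X} {nothing ∷ Y} (_ ∷ X⊑Y) =
  trans (+-suc (addedArrows X Y) (unmarked Y)) (cong suc (addedArrows+unmarked X⊑Y))
addedArrows+unmarked {X = nothing ∷ _} {just _ ∷ _} (_ ∷ X⊑Y) = cong suc (addedArrows+unmarked X⊑Y)
addedArrows+unmarked (just⊑just ∷ X⊑Y) = addedArrows+unmarked X⊑Y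

module _ (G : Graph) where

  Follower⇒Extends : ∀ {X Y} → Follower G X Y → Extends X Y
  Follower⇒Extends {X} (i , b , Xi≡nothing , refl , _) = Extends-[]≔ X i (just b) Xi≡nothing

  Follower⇒unmarked : ∀ {X Y} → Follower G X Y → suc (unmarked Y) ≡ unmarked X
  Follower⇒unmarked {X} (i , b , Xi≡nothing , refl , _) = unmarked-[]≔ X i b Xi≡nothing

  Reachable⇒Extends : ∀ {X Y} → ReachableFrom G X Y → Extends X Y
  Reachable⇒Extends here                   = Pointwise.refl ⊑-refl
  Reachable⇒Extends (step {X} {Y} XY YZ) =
    Pointwise.trans ⊑-trans (Follower⇒Extends {X} {Y} XY) (Reachable⇒Extends YZ)

  Reachable⇒IsState : ∀ {X Y} → IsState G X → ReachableFrom G X Y → IsState G Y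
  Reachable⇒IsState X-state here                                   = X-state
  Reachable⇒IsState _       (step (_ , _ , _ , refl , Y-state) YZ) = Reachable⇒IsState Y-state YZ

isOdd : ℕ → Bool
isOdd zero    = false
isOdd (suc n) = not (isOdd n)

isOdd-+ : ∀ m n → isOdd (m + n) ≡ isOdd m xor isOdd n
isOdd-+ zero    n = refl
isOdd-+ (suc m) n with isOdd m | isOdd-+ m n
... | true  | eq = trans (cong not eq) (not-involutive (isOdd n))
... | false | eq = cong not eq

bit : Bool → ℕ
bit b = if b then 1 else 0

bit-injective : ∀ {a b} → bit a ≡ bit b → a ≡ b
bit-injective {true}  {true}  _ = refl
bit-injective {false} {false} _ = refl
bit-injective {true}  {false} ()
bit-injective {false} {true}  ()

%2≡bit-isOdd : ∀ n → n % 2 ≡ bit (isOdd n)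
%2≡bit-isOdd zero          = refl
%2≡bit-isOdd (suc zero)    = refl
%2≡bit-isOdd (suc (suc n)) = trans (%2≡bit-isOdd n) (cong bit (sym (not-involutive (isOdd n))))

isOdd⇒%2 : ∀ m n → isOdd m ≡ isOdd n → m % 2 ≡ n % 2
isOdd⇒%2 m n eq = trans (%2≡bit-isOdd m) (trans (cong bit eq) (sym (%2≡bit-isOdd n)))

%2⇒isOdd : ∀ m n → m % 2 ≡ n % 2 → isOdd m ≡ isOdd n
%2⇒isOdd m n eq = bit-injective (trans (sym (%2≡bit-isOdd m)) (trans eq (%2≡bit-isOdd n)))

xor-cancelʳ : ∀ a b c → a xor c ≡ b → a ≡ b xor c
xor-cancelʳ a b c eq = begin
  a               ≡⟨ sym (xor-identityʳ a) ⟩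
  a xor false     ≡⟨ cong (a xor_) (sym (xor-same c)) ⟩
  a xor (c xor c) ≡⟨ sym (xor-assoc a c c) ⟩
  (a xor c) xor c ≡⟨ cong (_xor c) eq ⟩
  b xor c         ∎
  where open ≡-Reasoning

-- Grundy values of p(m)-moves states

∈-if⁻ : ∀ c {A : Set} {x y : A} → y ∈ (if c then x ∷ [] else []) → T c × y ≡ x
∈-if⁻ true (here y≡x) = tt , y≡x

∈-if⁺ : ∀ {c} {A : Set} {x : A} → T c → x ∈ (if c then x ∷ [] else [])
∈-if⁺ {true} _ = here refl

isNothing⇒≡nothing : ∀ {m : Mark} → T (isNothing m) → m ≡ nothing
isNothing⇒≡nothing {nothing} _ = refl

module _ (G : Graph) where

  Follower-PMoves : ∀ {X Y m} → PMoves G X m → Follower G X Y → PMoves G Y (suc m)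
  Follower-PMoves {X} {Y} {m} (_ , X-moves) XY@(_ , _ , _ , _ , Y-state) = Y-state , Y-moves
    where
    Y-moves : ∀ Z → ReachableFrom G Y Z → Terminal G Z → newArrows G Y Z % 2 ≡ suc m % 2
    Y-moves Z YZ Z-terminal = isOdd⇒%2 (addedArrows Y Z) (suc m) (begin
      isOdd (addedArrows Y Z)             ≡⟨ sym (not-involutive _) ⟩
      not (isOdd (suc (addedArrows Y Z))) ≡⟨ cong (not ∘ isOdd) XZ≡1+YZ ⟩
      not (isOdd (addedArrows X Z))       ≡⟨ cong not (%2⇒isOdd (addedArrows X Z) m (X-moves Z (step XY YZ) Z-terminal)) ⟩
      isOdd (suc m)                       ∎)
      where
      open ≡-Reasoning
      XZ≡1+YZ : suc (addedArrows Y Z) ≡ addedArrows X Z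
      XZ≡1+YZ = +-cancelʳ-≡ (unmarked Z) _ _ (begin
        suc (addedArrows Y Z + unmarked Z) ≡⟨ cong suc (addedArrows+unmarked (Reachable⇒Extends G YZ)) ⟩
        suc (unmarked Y)                   ≡⟨ Follower⇒unmarked G {X} {Y} XY ⟩
        unmarked X                         ≡⟨ sym (addedArrows+unmarked (Reachable⇒Extends G (step XY YZ))) ⟩
        addedArrows X Z + unmarked Z       ∎)

  PMoves-terminal : ∀ {X m} → PMoves G X m → Terminal G X → m % 2 ≡ 0
  PMoves-terminal {X} (_ , X-moves) X-terminal =
    trans (sym (X-moves X here X-terminal)) (cong (_% 2) (addedArrows-refl X))

  unmarked≡0⇒Terminal : ∀ {X} → unmarked X ≡ 0 → Terminal G X
  unmarked≡0⇒Terminal {X} X≡0 Y XY with trans (Follower⇒unmarked G {X} {Y} XY) X≡0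
  ... | ()

  ∈-followers⁻ : ∀ {X Y} → Y ∈ followers G X → Follower G X Y
  ∈-followers⁻ {X} {Y} Y∈
    with i , Y∈ᵢ ← Any.satisfied (∈-concatMap⁻ _ {xs = List.allFin (E G)} Y∈)
    with b , Y∈ᵢᵦ ← Any.satisfied (∈-concatMap⁻ _ {xs = true ∷ false ∷ []} Y∈ᵢ)
    with ok , refl ← ∈-if⁻ (isNothing (lookup X i) ∧ isState G (X [ i ]≔ just b)) {x = X [ i ]≔ just b} Y∈ᵢᵦ
    with Xi-free , Y-state ← Equivalence.to T-∧ ok
    = i , b , isNothing⇒≡nothing Xi-free , refl , Y-state

  ∈-followers⁺ : ∀ {X Y} → Follower G X Y → Y ∈ followers G X
  ∈-followers⁺ {X} (i , b , Xi≡nothing , refl , Y-state) =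
    ∈-concatMap⁺ followersAt (lose (∈-allFin i) (∈-concatMap⁺ (followerAt i) (lose (bool∈ b) (∈-if⁺ Y-allowed))))
    where
    followerAt : Fin (E G) → Bool → List (Decoration G)
    followerAt i b = if isNothing (lookup X i) ∧ isState G (X [ i ]≔ just b) then (X [ i ]≔ just b) ∷ [] else []
    followersAt : Fin (E G) → List (Decoration G)
    followersAt i = List.concatMap (followerAt i) (true ∷ false ∷ [])
    bool∈ : ∀ b → b ∈ true ∷ false ∷ []
    bool∈ true  = here refl
    bool∈ false = there (here refl)
    Y-allowed : T (isNothing (lookup X i) ∧ isState G (X [ i ]≔ just b))
    Y-allowed = subst (λ m → T (isNothing m ∧ isState G (X [ i ]≔ just b))) (sym Xi≡nothing) Y-state

∈⇒map≢[] : ∀ {A B : Set} {g : A → B} {x xs} → x ∈ xs → List.map g xs ≢ []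
∈⇒map≢[] {xs = _ ∷ _} _ ()

memberᵇ-absent : ∀ k c xs → (k ≡ᵇ c) ≡ false → All (_≡ c) xs → memberᵇ k xs ≡ false
memberᵇ-absent k c []       _   []            = refl
memberᵇ-absent k c (_ ∷ xs) k≢c (refl ∷ xs≡c) rewrite k≢c = memberᵇ-absent k c xs k≢c xs≡c

mex-alternating : ∀ b xs → All (_≡ bit (not b)) xs → (b ≡ true → xs ≢ []) → mex xs ≡ bit b
mex-alternating false xs xs≡1 _ =
  cong (λ t → if t then mexFrom (List.length xs) 1 xs else 0) (memberᵇ-absent 0 1 xs refl xs≡1)
mex-alternating true [] _ has-follower = ⊥-elim (has-follower refl refl)
mex-alternating true (_ ∷ xs) (refl ∷ xs≡0) _ =
  cong (λ t → if t then mexFrom (List.length xs) 2 (0 ∷ xs) else 1) (memberᵇ-absent 1 0 xs refl xs≡0)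

grundyFuel-PMoves : ∀ G f {X m} → PMoves G X m → unmarked X ≤ f → grundyFuel G f X ≡ m % 2
grundyFuel-PMoves G zero {X} {m} X-moves X≤0 =
  sym (PMoves-terminal G {X} {m} X-moves (unmarked≡0⇒Terminal G {X} (n≤0⇒n≡0 X≤0)))
grundyFuel-PMoves G (suc f) {X} {m} X-moves X≤1+f = begin
  mex (List.map (grundyFuel G f) (followers G X)) ≡⟨ mex-alternating (isOdd m) _ values has-follower ⟩
  bit (isOdd m)                                   ≡⟨ sym (%2≡bit-isOdd m) ⟩
  m % 2                                           ∎
  where
  open ≡-Reasoning
  value : ∀ {Y} → Y ∈ followers G X → grundyFuel G f Y ≡ bit (not (isOdd m))
  value {Y} Y∈ =
    trans (grundyFuel-PMoves G f {Y} {suc m} (Follower-PMoves G {X} {Y} {m} X-moves XY) Y≤f) (%2≡bit-isOdd (suc m))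
    where
    XY : Follower G X Y
    XY = ∈-followers⁻ G Y∈
    Y≤f : unmarked Y ≤ f
    Y≤f = s≤s⁻¹ (subst (_≤ suc f) (sym (Follower⇒unmarked G {X} {Y} XY)) X≤1+f)
  values : All (_≡ bit (not (isOdd m))) (List.map (grundyFuel G f) (followers G X))
  values = map⁺ (All.tabulate value)
  has-follower : isOdd m ≡ true → List.map (grundyFuel G f) (followers G X) ≢ []
  has-follower odd no-follower =
    0≢1+n (trans (sym (PMoves-terminal G {X} {m} X-moves X-terminal)) (trans (%2≡bit-isOdd m) (cong bit odd)))
    where
    X-terminal : Terminal G X
    X-terminal Y XY = ∈⇒map≢[] (∈-followers⁺ G {X} {Y} XY) no-follower

grundy-PMoves : ∀ G {X m} → PMoves G X m → grundy G X ≡ m % 2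
grundy-PMoves G {X} {m} X-moves = grundyFuel-PMoves G (E G) {X} {m} X-moves (unmarked≤length X)

-- Vertex conditions on lists of marked edges

EdgeMark : Set
EdgeMark = (ℕ × ℕ) × Mark

intoOrAway outOfOrAway : ℕ → EdgeMark → Bool
intoOrAway  v (e , m) = not (incident v e) ∨ arrowInto v e m
outOfOrAway v (e , m) = not (incident v e) ∨ arrowOutOf v e m

degreeIn : ℕ → List EdgeMark → ℕ
degreeIn v []            = 0
degreeIn v ((e , _) ∷ L) = if incident v e then suc (degreeIn v L) else degreeIn v L

-- Degree, sink flag and source flag of a vertex: all the state condition looks at.
Profile : Set
Profile = ℕ × Bool × Bool

profile : ℕ → List EdgeMark → Profile
profile v L = degreeIn v L , all (intoOrAway v) L , all (outOfOrAway v) L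

_⊗_ : Profile → Profile → Profile
(k , s , t) ⊗ (k′ , s′ , t′) = k + k′ , s ∧ s′ , t ∧ t′

acceptable : Profile → Bool
acceptable (k , sink , source) = not (2 ≤ᵇ k) ∨ (not sink ∧ not source)

vertexOK : List EdgeMark → ℕ → Bool
vertexOK L v = acceptable (profile v L)

filter-incident≡degreeIn : ∀ {k} v (es : Vec (ℕ × ℕ) k) (d : Vec Mark k) →
  List.length (List.filter (λ e → T? (incident v e)) (toList es)) ≡ degreeIn v (toList (zip es d))
filter-incident≡degreeIn v []       []      = refl
filter-incident≡degreeIn v (e ∷ es) (_ ∷ d) with incident v e
... | true  = cong suc (filter-incident≡degreeIn v es d)
... | false = filter-incident≡degreeIn v es d

isState≡all-vertexOK : ∀ G d → isState G d ≡ all (vertexOK (edgeMarks G d)) (upTo (V G))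
isState≡all-vertexOK G d = cong and (map-cong vertex≡ (upTo (V G)))
  where
  vertex≡ : ∀ v → not (2 ≤ᵇ degree G v) ∨ (not (isSink G d v) ∧ not (isSource G d v)) ≡ vertexOK (edgeMarks G d) v
  vertex≡ v = cong (λ k → not (2 ≤ᵇ k) ∨ (not (isSink G d v) ∧ not (isSource G d v)))
                   (filter-incident≡degreeIn v (edges G) d)

all-++ : ∀ {A : Set} (f : A → Bool) xs ys → all f (xs ++ ys) ≡ all f xs ∧ all f ys
all-++ f []       ys = refl
all-++ f (x ∷ xs) ys = trans (cong (f x ∧_) (all-++ f xs ys)) (sym (∧-assoc (f x) _ _))

all-congᴬ : ∀ {A : Set} {f g : A → Bool} {xs} → All (λ x → f x ≡ g x) xs → all f xs ≡ all g xs
all-congᴬ []             = refl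
all-congᴬ (fx≡gx ∷ f≡g) = cong₂ _∧_ fx≡gx (all-congᴬ f≡g)

degreeIn-++ : ∀ v xs ys → degreeIn v (xs ++ ys) ≡ degreeIn v xs + degreeIn v ys
degreeIn-++ v []             ys = refl
degreeIn-++ v ((e , _) ∷ xs) ys with incident v e
... | true  = cong suc (degreeIn-++ v xs ys)
... | false = degreeIn-++ v xs ys

profile-++ : ∀ v xs ys → profile v (xs ++ ys) ≡ profile v xs ⊗ profile v ys
profile-++ v xs ys = cong₂ _,_ (degreeIn-++ v xs ys) (cong₂ _,_ (all-++ _ xs ys) (all-++ _ xs ys))

Avoids : ℕ → List EdgeMark → Set
Avoids v = All (λ em → incident v (proj₁ em) ≡ false)

Avoids⇒profile : ∀ {v L} → Avoids v L → profile v L ≡ (0 , true , true)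
Avoids⇒profile [] = refl
Avoids⇒profile {v} {(e , _) ∷ _} (v∉e ∷ v∉L) with incident v e | v∉e | Avoids⇒profile {v} v∉L
... | false | refl | eq = eq

vertexOK-++-Avoids : ∀ xs {ys v} → Avoids v ys → vertexOK (xs ++ ys) v ≡ vertexOK xs v
vertexOK-++-Avoids xs {ys} {v} v∉ys = cong acceptable (begin
  profile v (xs ++ ys)                ≡⟨ profile-++ v xs ys ⟩
  profile v xs ⊗ profile v ys         ≡⟨ cong (profile v xs ⊗_) (Avoids⇒profile v∉ys) ⟩
  profile v xs ⊗ (0 , true , true)    ≡⟨ cong₂ _,_ (+-identityʳ _) (cong₂ _,_ (∧-identityʳ _) (∧-identityʳ _)) ⟩
  profile v xs                        ∎)
  where open ≡-Reasoning

≡ᵇ-refl : ∀ n → (n ≡ᵇ n) ≡ true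
≡ᵇ-refl zero    = refl
≡ᵇ-refl (suc n) = ≡ᵇ-refl n

≢⇒≡ᵇ≡false : ∀ {m n} → m ≢ n → (m ≡ᵇ n) ≡ false
≢⇒≡ᵇ≡false {zero}  {zero}  m≢n = ⊥-elim (m≢n refl)
≢⇒≡ᵇ≡false {zero}  {suc n} _   = refl
≢⇒≡ᵇ≡false {suc m} {zero}  _   = refl
≢⇒≡ᵇ≡false {suc m} {suc n} m≢n = ≢⇒≡ᵇ≡false (m≢n ∘ cong suc)

-- A leg edge is listed as (x , 1+x) with x nearer the hub: `just true` points away from the hub.
outward inward : Mark → Bool
outward (just true)  = true
outward _            = false
inward  (just false) = true
inward  _            = false

legEdge : ℕ → Mark → EdgeMark
legEdge x m = (x , suc x) , m

profile-legEdge-near : ∀ x m → profile x (legEdge x m ∷ []) ≡ (1 , inward m , outward m)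
profile-legEdge-near x (just true)  rewrite ≡ᵇ-refl x | ≢⇒≡ᵇ≡false (<⇒≢ (n<1+n x)) = refl
profile-legEdge-near x (just false) rewrite ≡ᵇ-refl x | ≢⇒≡ᵇ≡false (<⇒≢ (n<1+n x)) = refl
profile-legEdge-near x nothing      rewrite ≡ᵇ-refl x = refl

profile-legEdge-far : ∀ x m → profile (suc x) (legEdge x m ∷ []) ≡ (1 , outward m , inward m)
profile-legEdge-far x (just true)  rewrite ≡ᵇ-refl x | ≢⇒≡ᵇ≡false (>⇒≢ (n<1+n x)) = refl
profile-legEdge-far x (just false) rewrite ≡ᵇ-refl x | ≢⇒≡ᵇ≡false (>⇒≢ (n<1+n x)) = refl
profile-legEdge-far x nothing      rewrite ≡ᵇ-refl x | ≢⇒≡ᵇ≡false (>⇒≢ (n<1+n x)) = refl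

legEdge-avoids : ∀ {x y} m → y ≢ x → y ≢ suc x → Avoids y (legEdge x m ∷ [])
legEdge-avoids m y≢x y≢1+x = cong₂ _∨_ (≢⇒≡ᵇ≡false y≢x) (≢⇒≡ᵇ≡false y≢1+x) ∷ []

legMarks : ∀ {k} → ℕ → Vec Mark k → List EdgeMark
legMarks x []       = []
legMarks x (m ∷ ms) = legEdge x m ∷ legMarks (suc x) ms

legMarks-avoids : ∀ {k y} x (ms : Vec Mark k) → y < x → Avoids y (legMarks x ms)
legMarks-avoids x []       _   = []
legMarks-avoids x (m ∷ ms) y<x =
  ++⁺ (legEdge-avoids m (<⇒≢ y<x) (<⇒≢ y<1+x)) (legMarks-avoids (suc x) ms y<1+x)
  where y<1+x = <-trans y<x (n<1+n x)

zip-tabulate≡legMarks : ∀ {k} x (h : Fin k → ℕ × ℕ) → (∀ i → h i ≡ (x + toℕ i , suc (x + toℕ i))) →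
                        ∀ ms → toList (zip (tabulate h) ms) ≡ legMarks x ms
zip-tabulate≡legMarks x h h≡ []       = refl
zip-tabulate≡legMarks x h h≡ (m ∷ ms) = cong₂ _∷_
  (cong (_, m) (trans (h≡ fzero) (cong (λ z → z , suc z) (+-identityʳ x))))
  (zip-tabulate≡legMarks (suc x) (h ∘ fsuc) (λ i → trans (h≡ (fsuc i)) (cong (λ z → z , suc z) (+-suc x (toℕ i)))) ms)

interval : ℕ → ℕ → List ℕ
interval x zero    = []
interval x (suc k) = x ∷ interval (suc x) k

applyUpTo≡interval : ∀ (f : ℕ → ℕ) x k → (∀ i → f i ≡ x + i) → applyUpTo f k ≡ interval x k
applyUpTo≡interval f x zero    f≡ = refl
applyUpTo≡interval f x (suc k) f≡ = cong₂ _∷_ (trans (f≡ 0) (+-identityʳ x))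
  (applyUpTo≡interval (f ∘ suc) (suc x) k (λ i → trans (f≡ (suc i)) (+-suc x i)))

legVertexOK : Mark → Mark → Bool
legVertexOK e m = not (outward e ∧ inward m) ∧ not (inward e ∧ outward m)

legOK : ∀ {k} → Mark → Vec Mark k → Bool
legOK e []       = true
legOK e (m ∷ ms) = legVertexOK e m ∧ legOK m ms

EndsAt : ℕ → Mark → List EdgeMark → Set
EndsAt x e pre = profile x pre ≡ (1 , outward e , inward e) × (∀ {y} → x < y → Avoids y pre)

EndsAt-step : ∀ {x e pre} m → EndsAt x e pre → EndsAt (suc x) m (pre ++ legEdge x m ∷ [])
EndsAt-step {x} {e} {pre} m (x-end , beyond) = far-end , far-beyond
  where
  open ≡-Reasoning
  far-end : profile (suc x) (pre ++ legEdge x m ∷ []) ≡ (1 , outward m , inward m)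
  far-end = begin
    profile (suc x) (pre ++ legEdge x m ∷ [])
      ≡⟨ profile-++ (suc x) pre _ ⟩
    profile (suc x) pre ⊗ profile (suc x) (legEdge x m ∷ [])
      ≡⟨ cong₂ _⊗_ (Avoids⇒profile {suc x} (beyond (n<1+n x))) (profile-legEdge-far x m) ⟩
    (0 , true , true) ⊗ (1 , outward m , inward m) ∎
  far-beyond : ∀ {y} → suc x < y → Avoids y (pre ++ legEdge x m ∷ [])
  far-beyond 1+x<y = ++⁺ (beyond x<y) (legEdge-avoids m (>⇒≢ x<y) (>⇒≢ 1+x<y))
    where x<y = <-trans (n<1+n x) 1+x<y

vertexOK-EndsAt : ∀ {x e pre} m → EndsAt x e pre → vertexOK (pre ++ legEdge x m ∷ []) x ≡ legVertexOK e m
vertexOK-EndsAt {x} {e} {pre} m (x-end , _) = cong acceptable (begin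
  profile x (pre ++ legEdge x m ∷ [])               ≡⟨ profile-++ x pre _ ⟩
  profile x pre ⊗ profile x (legEdge x m ∷ [])      ≡⟨ cong₂ _⊗_ x-end (profile-legEdge-near x m) ⟩
  (1 , outward e , inward e) ⊗ (1 , inward m , outward m) ∎)
  where open ≡-Reasoning

all-vertexOK-leg : ∀ {k} x e (ms : Vec Mark k) pre → EndsAt x e pre →
                   all (vertexOK (pre ++ legMarks x ms)) (interval x (suc k)) ≡ legOK e ms
all-vertexOK-leg x e [] pre (x-end , _) =
  cong (λ p → acceptable p ∧ true) (trans (cong (profile x) (++-identityʳ pre)) x-end)
all-vertexOK-leg {suc k} x e (m ∷ ms) pre ends = begin
  all (vertexOK (pre ++ legMarks x (m ∷ ms))) (interval x (2 + k))
    ≡⟨ cong (λ L → all (vertexOK L) (interval x (2 + k))) (sym (++-assoc pre (legEdge x m ∷ []) (legMarks (suc x) ms))) ⟩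
  vertexOK (pre′ ++ legMarks (suc x) ms) x ∧ all (vertexOK (pre′ ++ legMarks (suc x) ms)) (interval (suc x) (suc k))
    ≡⟨ cong₂ _∧_ (trans (vertexOK-++-Avoids pre′ (legMarks-avoids (suc x) ms (n<1+n x))) (vertexOK-EndsAt m ends))
                 (all-vertexOK-leg (suc x) m ms pre′ (EndsAt-step m ends)) ⟩
  legVertexOK e m ∧ legOK m ms ∎
  where
  open ≡-Reasoning
  pre′ = pre ++ legEdge x m ∷ []

-- States of the spider S(2,2,n+1)

S₂₂ : ℕ → Graph
S₂₂ n = Spider 2 2 (suc n)

-- The first five edges of S₂₂ n, in the order of `edges`: the u-leg, the v-leg, the hub edge of the w-leg.
hubMarks : Mark → Mark → Mark → Mark → Mark → List EdgeMark
hubMarks a m₁ b m₃ e₀ = ((0 , 1) , a) ∷ ((1 , 2) , m₁) ∷ ((0 , 3) , b) ∷ ((3 , 4) , m₃) ∷ ((0 , 5) , e₀) ∷ []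

hubOK : Mark → Mark → Mark → Mark → Mark → Bool
hubOK a m₁ b m₃ e₀ = all (vertexOK (hubMarks a m₁ b m₃ e₀)) (0 ∷ 1 ∷ 2 ∷ 3 ∷ 4 ∷ [])

spiderOK : ∀ {n} → Vec Mark (5 + n) → Bool
spiderOK (a ∷ m₁ ∷ b ∷ m₃ ∷ e₀ ∷ rest) = hubOK a m₁ b m₃ e₀ ∧ legOK e₀ rest

isState-S₂₂ : ∀ n (X : Vec Mark (5 + n)) → isState (S₂₂ n) X ≡ spiderOK X
isState-S₂₂ n X@(a ∷ m₁ ∷ b ∷ m₃ ∷ e₀ ∷ rest) = begin
  isState (S₂₂ n) X
    ≡⟨ isState≡all-vertexOK (S₂₂ n) X ⟩
  all (vertexOK (P ++ toList (zip (tabulate wEdge) rest))) (hubVertices ++ applyUpTo (5 +_) (suc n))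
    ≡⟨ cong₂ (λ L vs → all (vertexOK (P ++ L)) (hubVertices ++ vs))
             (zip-tabulate≡legMarks 5 wEdge (λ _ → refl) rest) (applyUpTo≡interval (5 +_) 5 (suc n) (λ _ → refl)) ⟩
  all (vertexOK (P ++ legMarks 5 rest)) (hubVertices ++ interval 5 (suc n))
    ≡⟨ all-++ (vertexOK (P ++ legMarks 5 rest)) hubVertices (interval 5 (suc n)) ⟩
  all (vertexOK (P ++ legMarks 5 rest)) hubVertices ∧ all (vertexOK (P ++ legMarks 5 rest)) (interval 5 (suc n))
    ≡⟨ cong₂ _∧_ (all-congᴬ {f = vertexOK (P ++ legMarks 5 rest)} {g = vertexOK P} {xs = hubVertices} hub-unaffected)
                 (all-vertexOK-leg 5 e₀ rest P (P-ends-at-5 e₀ , P-avoids-beyond)) ⟩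
  hubOK a m₁ b m₃ e₀ ∧ legOK e₀ rest ∎
  where
  open ≡-Reasoning
  P = hubMarks a m₁ b m₃ e₀
  hubVertices : List ℕ
  hubVertices = 0 ∷ 1 ∷ 2 ∷ 3 ∷ 4 ∷ []
  wEdge : Fin n → ℕ × ℕ
  wEdge i = 5 + toℕ i , 6 + toℕ i
  hub : ∀ v → T (v <ᵇ 5) → vertexOK (P ++ legMarks 5 rest) v ≡ vertexOK P v
  hub v v<5 = vertexOK-++-Avoids P {legMarks 5 rest} {v} (legMarks-avoids {y = v} 5 rest (<ᵇ⇒< v 5 v<5))
  hub-unaffected : All (λ v → vertexOK (P ++ legMarks 5 rest) v ≡ vertexOK P v) hubVertices
  hub-unaffected = hub 0 tt ∷ hub 1 tt ∷ hub 2 tt ∷ hub 3 tt ∷ hub 4 tt ∷ []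
  P-ends-at-5 : ∀ e → profile 5 (hubMarks a m₁ b m₃ e) ≡ (1 , outward e , inward e)
  P-ends-at-5 (just true)  = refl
  P-ends-at-5 (just false) = refl
  P-ends-at-5 nothing      = refl
  P-avoids-beyond : ∀ {y} → 5 < y → Avoids y P
  P-avoids-beyond (s≤s (s≤s (s≤s (s≤s (s≤s (s≤s _)))))) = refl ∷ refl ∷ refl ∷ refl ∷ refl ∷ []

-- Terminal states of the spider S(2,2,n+1)

lastMark : ∀ {k} → Mark → Vec Mark k → Mark
lastMark m []        = m
lastMark _ (m ∷ ms) = lastMark m ms

BlockedLeg : ∀ {k} → Mark → Vec Mark k → Set
BlockedLeg e ms = ∀ j b → lookup ms j ≡ nothing → ¬ T (legOK e (ms [ j ]≔ just b))

-- An unmarked edge of a blocked leg lies between two arrows pointing towards it (an arrow continuing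
-- the previous one could otherwise be added), so the direction of the arrows flips exactly there.
blockedLeg-parity : ∀ {k} c d (ms : Vec Mark k) → T (legOK (just c) ms) → lastMark (just c) ms ≡ just d →
                    BlockedLeg (just c) ms → isOdd (unmarked ms) ≡ c xor d
blockedLeg-parity true  .true  []                   _  refl _       = refl
blockedLeg-parity false .false []                   _  refl _       = refl
blockedLeg-parity true  d (just true ∷ ms)          ok last blocked = blockedLeg-parity true d ms ok last (blocked ∘ fsuc)
blockedLeg-parity false d (just false ∷ ms)         ok last blocked = blockedLeg-parity false d ms ok last (blocked ∘ fsuc)
blockedLeg-parity c     d (nothing ∷ [])            _  ()   _
blockedLeg-parity true  d (nothing ∷ just false ∷ ms) ok last blocked =
  cong not (blockedLeg-parity false d ms ok last (blocked ∘ fsuc ∘ fsuc))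
blockedLeg-parity false d (nothing ∷ just true ∷ ms) ok last blocked =
  trans (cong not (blockedLeg-parity true d ms ok last (blocked ∘ fsuc ∘ fsuc))) (not-involutive d)
blockedLeg-parity true  d (nothing ∷ just true ∷ _)  ok _ blocked = ⊥-elim (blocked fzero true refl ok)
blockedLeg-parity true  d (nothing ∷ nothing ∷ _)    ok _ blocked = ⊥-elim (blocked fzero true refl ok)
blockedLeg-parity false d (nothing ∷ just false ∷ _) ok _ blocked = ⊥-elim (blocked fzero false refl ok)
blockedLeg-parity false d (nothing ∷ nothing ∷ _)    ok _ blocked = ⊥-elim (blocked fzero false refl ok)

Blocked : ∀ {n} → Vec Mark (5 + n) → Set
Blocked X = ∀ i b → lookup X i ≡ nothing → ¬ T (spiderOK (X [ i ]≔ just b))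

-- The outer edges of the u- and v-legs point toward the hub, so their hub edges are unmarked or point
-- into the hub.  Blocking forces both to point into the hub, except that exactly one stays unmarked
-- when the w-edge also points into the hub (the hub would otherwise be a sink).
hub-parity : ∀ {n} a b c d (rest : Vec Mark n) → isOdd (unmarked rest) ≡ c xor d →
             T (hubOK a (just false) b (just false) (just c)) →
             (a ≡ nothing → ¬ T (hubOK (just false) (just false) b (just false) (just c))) →
             (b ≡ nothing → ¬ T (hubOK a (just false) (just false) (just false) (just c))) →
             isOdd (unmarked (a ∷ just false ∷ b ∷ just false ∷ just c ∷ rest)) ≡ not d
hub-parity (just false) (just false) true  d rest leg _ _ _ = leg
hub-parity nothing      (just false) false d rest leg _ _ _ = cong not leg
hub-parity (just false) nothing      false d rest leg _ _ _ = cong not leg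
hub-parity nothing      nothing      true  d rest _ _ a-blocked _ = ⊥-elim (a-blocked refl tt)
hub-parity nothing      nothing      false d rest _ _ a-blocked _ = ⊥-elim (a-blocked refl tt)
hub-parity nothing      (just false) true  d rest _ _ a-blocked _ = ⊥-elim (a-blocked refl tt)
hub-parity (just false) nothing      true  d rest _ _ _ b-blocked = ⊥-elim (b-blocked refl tt)
hub-parity (just false) (just false) false d rest _ () _ _
hub-parity (just true)  nothing      true  d rest _ () _ _
hub-parity (just true)  nothing      false d rest _ () _ _
hub-parity (just true)  (just true)  true  d rest _ () _ _
hub-parity (just true)  (just true)  false d rest _ () _ _
hub-parity (just true)  (just false) true  d rest _ () _ _
hub-parity (just true)  (just false) false d rest _ () _ _
hub-parity (just false) (just true)  true  d rest _ () _ _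
hub-parity (just false) (just true)  false d rest _ () _ _
hub-parity nothing      (just true)  true  d rest _ () _ _
hub-parity nothing      (just true)  false d rest _ () _ _

hub-unmarked : ∀ a b → T (hubOK a (just false) b (just false) nothing) →
               (a ≡ nothing → ¬ T (hubOK (just false) (just false) b (just false) nothing)) →
               (b ≡ nothing → ¬ T (hubOK a (just false) (just false) (just false) nothing)) →
               a ≡ just false × b ≡ just false
hub-unmarked (just false) (just false) _ _ _         = refl , refl
hub-unmarked nothing      nothing      _ a-blocked _ = ⊥-elim (a-blocked refl tt)
hub-unmarked nothing      (just false) _ a-blocked _ = ⊥-elim (a-blocked refl tt)
hub-unmarked nothing      (just true)  () _ _
hub-unmarked (just false) nothing      _ _ b-blocked = ⊥-elim (b-blocked refl tt)
hub-unmarked (just true)  nothing      () _ _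
hub-unmarked (just true)  (just true)  () _ _
hub-unmarked (just true)  (just false) () _ _
hub-unmarked (just false) (just true)  () _ _

w-next-inward : ∀ {k} r₀ (rest : Vec Mark k) → T (legOK r₀ rest) →
                ¬ T (hubOK (just false) (just false) (just false) (just false) (just true) ∧ legOK (just true) (r₀ ∷ rest)) →
                r₀ ≡ just false
w-next-inward (just false) _ _  _       = refl
w-next-inward (just true)  _ ok blocked = ⊥-elim (blocked ok)
w-next-inward nothing      _ ok blocked = ⊥-elim (blocked ok)

terminal-parity : ∀ {n} a b e₀ (rest : Vec Mark n) d → lastMark e₀ rest ≡ just d →
                  T (spiderOK (a ∷ just false ∷ b ∷ just false ∷ e₀ ∷ rest)) →
                  Blocked (a ∷ just false ∷ b ∷ just false ∷ e₀ ∷ rest) →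
                  isOdd (unmarked (a ∷ just false ∷ b ∷ just false ∷ e₀ ∷ rest)) ≡ not d
terminal-parity a b (just c) rest d last ok blocked
  with hub-ok , leg-ok ← T-∧.to ok
  = hub-parity a b c d rest leg-parity hub-ok
      (λ a≡nothing hub′ → blocked fzero false a≡nothing (T-∧.from (hub′ , leg-ok)))
      (λ b≡nothing hub′ → blocked (fsuc (fsuc fzero)) false b≡nothing (T-∧.from (hub′ , leg-ok)))
  where
  leg-parity : isOdd (unmarked rest) ≡ c xor d
  leg-parity = blockedLeg-parity c d rest leg-ok last
    (λ j b′ free leg′ → blocked (fsuc (fsuc (fsuc (fsuc (fsuc j))))) b′ free (T-∧.from (hub-ok , leg′)))
terminal-parity a b nothing (r₀ ∷ rest) d last ok blocked
  with hub-ok , leg-ok ← T-∧.to ok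
  with refl , refl ← hub-unmarked a b hub-ok
         (λ a≡nothing hub′ → blocked fzero false a≡nothing (T-∧.from (hub′ , leg-ok)))
         (λ b≡nothing hub′ → blocked (fsuc (fsuc fzero)) false b≡nothing (T-∧.from (hub′ , leg-ok)))
  with refl ← w-next-inward r₀ rest leg-ok (blocked (fsuc (fsuc (fsuc (fsuc fzero)))) true refl)
  = cong not (blockedLeg-parity false d rest leg-ok last
      (λ j b′ free leg′ → blocked (fsuc (fsuc (fsuc (fsuc (fsuc (fsuc j)))))) b′ free (T-∧.from (hub-ok , leg′))))

-- S[1̌,1̌,ň] for x = false and S[1̌,1̌,n̂] for x = true.
spiderStart : ∀ n → Bool → Vec Mark (5 + n)
spiderStart n x = nothing ∷ just false ∷ nothing ∷ just false ∷ (replicate n nothing ∷ʳ just x)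

legOK-replicate : ∀ k x → T (legOK nothing (replicate k nothing ∷ʳ just x))
legOK-replicate zero    _ = tt
legOK-replicate (suc k) x = legOK-replicate k x

spiderStart-OK : ∀ n x → T (spiderOK (spiderStart n x))
spiderStart-OK zero    true  = tt
spiderStart-OK zero    false = tt
spiderStart-OK (suc n) x     = legOK-replicate n x

unmarked-replicate : ∀ k x → unmarked (replicate k nothing ∷ʳ just x) ≡ k
unmarked-replicate zero    _ = refl
unmarked-replicate (suc k) x = cong suc (unmarked-replicate k x)

lastMark-Extends : ∀ {k} x e (ms : Vec Mark k) → Extends (replicate k nothing ∷ʳ just x) (e ∷ ms) →
                   lastMark e ms ≡ just x
lastMark-Extends x e []        (just⊑just ∷ []) = refl
lastMark-Extends x e (m ∷ ms) (_ ∷ ms⊒)        = lastMark-Extends x m ms ms⊒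

spiderStart-PMoves : ∀ n x m → isOdd m ≡ isOdd n xor not x → PMoves (S₂₂ n) (spiderStart n x) m
spiderStart-PMoves n x m m≡ = start-state , moves
  where
  start-state : IsState (S₂₂ n) (spiderStart n x)
  start-state = subst T (sym (isState-S₂₂ n (spiderStart n x))) (spiderStart-OK n x)
  moves : ∀ X → ReachableFrom (S₂₂ n) (spiderStart n x) X → Terminal (S₂₂ n) X →
          newArrows (S₂₂ n) (spiderStart n x) X % 2 ≡ m % 2
  moves (a ∷ _ ∷ b ∷ _ ∷ e₀ ∷ rest) reach terminal
    with start⊑X@(_ ∷ just⊑just ∷ _ ∷ just⊑just ∷ leg⊒) ← Reachable⇒Extends (S₂₂ n) reach
    = isOdd⇒%2 (addedArrows (spiderStart n x) X) m (begin
      isOdd added                     ≡⟨ xor-cancelʳ (isOdd added) (isOdd n) (isOdd (unmarked X)) added+unmarked-parity ⟩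
      isOdd n xor isOdd (unmarked X)  ≡⟨ cong (isOdd n xor_) X-parity ⟩
      isOdd n xor not x               ≡⟨ sym m≡ ⟩
      isOdd m                         ∎)
    where
    open ≡-Reasoning
    X = a ∷ just false ∷ b ∷ just false ∷ e₀ ∷ rest
    added = addedArrows (spiderStart n x) X
    X-blocked : Blocked X
    X-blocked i c free ok = terminal (X [ i ]≔ just c) (i , c , free , refl , subst T (sym (isState-S₂₂ n (X [ i ]≔ just c))) ok)
    X-parity : isOdd (unmarked X) ≡ not x
    X-parity = terminal-parity a b e₀ rest x (lastMark-Extends x e₀ rest leg⊒)
      (subst T (isState-S₂₂ n X) (Reachable⇒IsState (S₂₂ n) start-state reach)) X-blocked
    added+unmarked-parity : isOdd added xor isOdd (unmarked X) ≡ isOdd n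
    added+unmarked-parity = begin
      isOdd added xor isOdd (unmarked X) ≡⟨ sym (isOdd-+ added (unmarked X)) ⟩
      isOdd (added + unmarked X)         ≡⟨ cong isOdd (addedArrows+unmarked start⊑X) ⟩
      isOdd (2 + unmarked (replicate n nothing ∷ʳ just x)) ≡⟨ cong (isOdd ∘ (2 +_)) (unmarked-replicate n x) ⟩
      isOdd (2 + n)                      ≡⟨ not-involutive (isOdd n) ⟩
      isOdd n                            ∎

1+n%2≡n%2⊕1 : ∀ n → suc n % 2 ≡ (n % 2) ⊕ 1
1+n%2≡n%2⊕1 n rewrite %2≡bit-isOdd (suc n) | %2≡bit-isOdd n with isOdd n
... | true  = refl
... | false = refl

mainTheorem12 : (n : ℕ) →
    PMoves (SpiderOf (check 1) (check 1) (check n)) S[ check 1 , check 1 , check n ] (suc n)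
    × PMoves (SpiderOf (check 1) (check 1) (hat n)) S[ check 1 , check 1 , hat n ] n
    × grundy (SpiderOf (check 1) (check 1) (check n)) S[ check 1 , check 1 , check n ] ≡ (n % 2) ⊕ 1
    × grundy (SpiderOf (check 1) (check 1) (hat n)) S[ check 1 , check 1 , hat n ] ≡ n % 2
mainTheorem12 n = check-moves , hat-moves ,
  trans (grundy-PMoves (S₂₂ n) {spiderStart n false} {suc n} check-moves) (1+n%2≡n%2⊕1 n) ,
  grundy-PMoves (S₂₂ n) {spiderStart n true} {n} hat-moves
  where
  check-moves : PMoves (S₂₂ n) (spiderStart n false) (suc n)
  check-moves = spiderStart-PMoves n false (suc n) (xor-comm true (isOdd n))
  hat-moves : PMoves (S₂₂ n) (spiderStart n true) n
  hat-moves = spiderStart-PMoves n true n (sym (xor-identityʳ (isOdd n)))
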